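{- For every Roman graph $G$ (with maximum degree at least two), $b_R(G) \geq b(G)$. The bound is sharp for cycles $C_n$ with $n \equiv 0 \pmod 3$.
   Context: All graphs are finite and simple. A dominating set of $G$ is a set $S \subseteq V(G)$ such that every vertex outside $S$ has a neighbor in $S$; $\gamma(G)$ is the minimum cardinality of a dominating set. The bondage number $b(G)$ is the minimum number of edges whose removal from $G$ yields a graph with larger domination number. A Roman dominating function on $G$ is a function $f: V(G) \to \{0,1,2\}$ such that every vertex $v$ with $f(v)=0$ has a neighbor $u$ with $f(u)=2$; its weight is $\sum_v f(v)$, and $\gamma_R(G)$ is the minimum weight of such a function. $G$ is called Roman if $\gamma_R(G) = 2\gamma(G)$. For a graph $G$ with maximum degree at least two, the Roman bondage number $b_R(G)$ is the minimum cardinality of a set $E' \subseteq E(G)$ with $\gamma_R(G - E') > \gamma_R(G)$, where $G-E'$ is obtained by deleting the edges of $E'$. The paper's standing assumption is that whenever $b_R(G)$ is discussed, $G$ has maximum degree at least two. -}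

module Defs where

open import Data.Nat using (ℕ; zero; suc; _≤_; _<_; _*_; _%_; _≡ᵇ_; _<ᵇ_)
open import Data.Bool using (Bool; true; false; _∧_; _∨_; not; if_then_else_)
open import Data.Fin using (Fin; toℕ)
import Data.Fin as F
open import Data.Fin.Subset using (Subset; _∈_; ∣_∣)
open import Data.List using (List; map; allFin)
open import Data.Nat.ListAction using (sum)
open import Data.Product using (Σ; ∃; _×_; _,_)
open import Data.Sum using (_⊎_)
open import Relation.Binary.PropositionalEquality using (_≡_)

Graph : ℕ → Set
Graph n = Fin n → Fin n → Bool

Simple : ∀ {n} → Graph n → Set
Simple G = (∀ i j → G i j ≡ G j i) × (∀ i → G i i ≡ false)

EdgeSubset : ∀ {n} → Graph n → Graph n → Set
EdgeSubset G E = (∀ i j → E i j ≡ E j i) × (∀ i j → E i j ≡ true → G i j ≡ true)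

-- Number of edges of a symmetric relation: unordered pairs {i,j}, i < j.
edgeCount : ∀ {n} → Graph n → ℕ
edgeCount {n} E =
  sum (map (λ i → sum (map (λ j → if (toℕ i <ᵇ toℕ j) ∧ E i j then 1 else 0) (allFin n))) (allFin n))

_─_ : ∀ {n} → Graph n → Graph n → Graph n
(G ─ E) i j = G i j ∧ not (E i j)

degree : ∀ {n} → Graph n → Fin n → ℕ
degree {n} G v = sum (map (λ u → if G v u then 1 else 0) (allFin n))

MaxDegree≥2 : ∀ {n} → Graph n → Set
MaxDegree≥2 G = ∃ λ v → 2 ≤ degree G v

IsMin : (ℕ → Set) → ℕ → Set
IsMin P k = P k × (∀ m → P m → k ≤ m)

Dominating : ∀ {n} → Graph n → Subset n → Set
Dominating G S = ∀ v → v ∈ S ⊎ (∃ λ u → u ∈ S × G u v ≡ true)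

DomNum : ∀ {n} → Graph n → ℕ → Set
DomNum {n} G = IsMin (λ k → Σ (Subset n) λ S → Dominating G S × ∣ S ∣ ≡ k)

RomanDominating : ∀ {n} → Graph n → (Fin n → Fin 3) → Set
RomanDominating G f = ∀ v → f v ≡ F.zero → ∃ λ u → G v u ≡ true × f u ≡ F.suc (F.suc F.zero)

weight : ∀ {n} → (Fin n → Fin 3) → ℕ
weight {n} f = sum (map (λ v → toℕ (f v)) (allFin n))

RomanNum : ∀ {n} → Graph n → ℕ → Set
RomanNum {n} G = IsMin (λ k → Σ (Fin n → Fin 3) λ f → RomanDominating G f × weight f ≡ k)

IsRoman : ∀ {n} → Graph n → Set
IsRoman G = ∀ g r → DomNum G g → RomanNum G r → r ≡ 2 * g

DomIncreases : ∀ {n} → Graph n → Graph n → Set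
DomIncreases G H = ∀ g h → DomNum G g → DomNum H h → g < h

RomanIncreases : ∀ {n} → Graph n → Graph n → Set
RomanIncreases G H = ∀ r s → RomanNum G r → RomanNum H s → r < s

BondageNum : ∀ {n} → Graph n → ℕ → Set
BondageNum {n} G = IsMin (λ b → Σ (Graph n) λ E →
  EdgeSubset G E × edgeCount E ≡ b × DomIncreases G (G ─ E))

RomanBondageNum : ∀ {n} → Graph n → ℕ → Set
RomanBondageNum {n} G = IsMin (λ b → Σ (Graph n) λ E →
  EdgeSubset G E × edgeCount E ≡ b × RomanIncreases G (G ─ E))

-- The cycle C_{m+1} on vertices 0..m, i ~ j iff j ≡ i+1 or i ≡ j+1 (mod m+1).
cycle : ∀ m → Graph (suc m)
cycle m i j = ((suc (toℕ i) % suc m) ≡ᵇ toℕ j) ∨ ((suc (toℕ j) % suc m) ≡ᵇ toℕ i)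

module Submission where

-- Every graph has γ_R ≤ 2γ (label a dominating set by 2). So if deleting E raises γ_R of a
-- Roman graph G, then 2γ(G) = γ_R(G) < γ_R(G - E) ≤ 2γ(G - E): every Roman bondage set is
-- a bondage set, and b(G) ≤ b_R(G).
--
-- For sharpness, count: a Roman dominating function f satisfies
-- n ≤ |V₁| + Σ_{f(u)=2} (1 + deg u), hence 2n ≤ 3·w(f) when all degrees are at most 2,
-- strictly so if some vertex is isolated. On C_{3k} this gives γ_R = 2k and γ = k, and
-- both values survive the deletion of one edge, since every third vertex, suitably
-- phased, still dominates the remaining Hamiltonian path. Deleting the two edges at a
-- vertex isolates it and raises both parameters, so b(C_{3k}) = b_R(C_{3k}) = 2.

open import Defs
open import Data.Bool using (Bool; true; false; T; not; _∧_; _∨_; if_then_else_)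
open import Data.Bool.Properties using (∨-comm; ¬-not; ∧-zeroʳ)
open import Data.Empty using (⊥-elim)
open import Data.Fin using (Fin; zero; suc; toℕ; fromℕ<; fromℕ; inject₁)
open import Data.Fin.Patterns using (0F; 1F; 2F)
open import Data.Fin.Properties using (_≟_; any?)
import Data.Fin.Properties as Finₚ
open import Data.Fin.Subset using (Subset; _∈_; ∣_∣)
open import Data.List using (map; tabulate; allFin)
open import Data.List.Properties using (map-tabulate; map-cong)
open import Data.Nat hiding (_≟_)
open import Data.Nat.Divisibility using (_∣_; m%n≡0⇒n∣m)
open import Data.Nat.DivMod using (m%n<n; %-distribˡ-+; m∣n⇒o%n%m≡o%m; m*n%n≡0; m<n⇒m%n≡m; n%n≡0)
open import Data.Nat.Induction using (<-rec)
open import Data.Nat.ListAction using () renaming (sum to sumᴸ)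
open import Data.Nat.Properties hiding (_≟_)
open import Algebra.Properties.Semiring.Sum +-*-semiring
  using (sum; sum-syntax; ∑-comm; ∑-distrib-+; *-distribˡ-sum; sum-cong-≗; sum-replicate-zero)
open import Data.Product using (Σ; ∃; _×_; _,_; proj₁)
open import Data.Sum using (_⊎_; inj₁; inj₂)
open import Data.Vec using ([]; _∷_; lookup)
import Data.Vec as Vec
open import Data.Vec.Properties using ([]=⇒lookup; lookup⇒[]=; lookup∘tabulate)
open import Function using (id; _∘_)
open import Relation.Binary.Definitions using (tri<; tri≈; tri>)
open import Relation.Binary.PropositionalEquality
open import Relation.Nullary using (¬_; Dec; yes; no; contradiction)
open import Relation.Nullary.Decidable using (decidable-stable; T?; ⌊_⌋)

T⇒≡true : ∀ {b} → T b → b ≡ true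
T⇒≡true {true} _ = refl

≡true⇒T : ∀ {b} → b ≡ true → T b
≡true⇒T refl = _

-- Finite sums

⟦_⟧ : Bool → ℕ
⟦ b ⟧ = if b then 1 else 0

sum-allFin : ∀ {n} (g : Fin n → ℕ) → sumᴸ (map g (allFin n)) ≡ sum g
sum-allFin g = trans (cong sumᴸ (map-tabulate id g)) (sum-tabulate g)
  where
  sum-tabulate : ∀ {n} (g : Fin n → ℕ) → sumᴸ (tabulate g) ≡ sum g
  sum-tabulate {zero} g = refl
  sum-tabulate {suc n} g = cong (g zero +_) (sum-tabulate (g ∘ suc))

∑-one : ∀ n → ∑[ i < n ] 1 ≡ n
∑-one zero = refl
∑-one (suc n) = cong suc (∑-one n)

sum-zero : ∀ {n} {f : Fin n → ℕ} → (∀ i → f i ≡ 0) → sum f ≡ 0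
sum-zero {n} f≡0 = trans (sum-cong-≗ f≡0) (sum-replicate-zero n)

sum-mono-≤ : ∀ {n} {f g : Fin n → ℕ} → (∀ i → f i ≤ g i) → sum f ≤ sum g
sum-mono-≤ {zero} f≤g = z≤n
sum-mono-≤ {suc n} f≤g = +-mono-≤ (f≤g zero) (sum-mono-≤ (f≤g ∘ suc))

sum-mono-< : ∀ {n} {f g : Fin n → ℕ} → (∀ i → f i ≤ g i) → ∀ i → f i < g i → sum f < sum g
sum-mono-< f≤g zero f<g = +-mono-<-≤ f<g (sum-mono-≤ (f≤g ∘ suc))
sum-mono-< f≤g (suc i) f<g = +-mono-≤-< (f≤g zero) (sum-mono-< (f≤g ∘ suc) i f<g)

term≤sum : ∀ {n} (f : Fin n → ℕ) i → f i ≤ sum f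
term≤sum f zero = m≤m+n (f zero) _
term≤sum f (suc i) = ≤-trans (term≤sum (f ∘ suc) i) (m≤n+m _ (f zero))

two-terms≤sum : ∀ {n} (f : Fin n → ℕ) {i j} → i ≢ j → f i + f j ≤ sum f
two-terms≤sum f {zero} {zero} i≢j = ⊥-elim (i≢j refl)
two-terms≤sum f {zero} {suc j} _ = +-monoʳ-≤ (f zero) (term≤sum (f ∘ suc) j)
two-terms≤sum f {suc i} {zero} _ =
  subst (_≤ sum f) (+-comm (f zero) _) (+-monoʳ-≤ (f zero) (term≤sum (f ∘ suc) i))
two-terms≤sum f {suc i} {suc j} i≢j =
  ≤-trans (two-terms≤sum (f ∘ suc) (i≢j ∘ cong suc)) (m≤n+m _ (f zero))

two-entries≤∑∑ : ∀ {n} (M : Fin n → Fin n → ℕ) {i j k l} → i ≢ k ⊎ j ≢ l →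
                 M i j + M k l ≤ ∑[ a < n ] ∑[ b < n ] M a b
two-entries≤∑∑ M {i} {j} {k} {l} different with i ≟ k
... | no i≢k = ≤-trans (+-mono-≤ (term≤sum (M i) j) (term≤sum (M k) l))
                       (two-terms≤sum (λ a → sum (M a)) i≢k)
... | yes refl with different
...   | inj₁ i≢i = ⊥-elim (i≢i refl)
...   | inj₂ j≢l = ≤-trans (two-terms≤sum (M i) j≢l) (term≤sum (λ a → sum (M a)) i)

sum-atMostOne : ∀ {n p} {P : Fin n → Set p} (P? : ∀ i → Dec (P i)) → (∀ {i j} → P i → P j → i ≡ j) →
                ∑[ i < n ] ⟦ ⌊ P? i ⌋ ⟧ ≤ 1
sum-atMostOne {zero} P? unique = z≤n
sum-atMostOne {suc n} P? unique with P? zero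
... | no _ = sum-atMostOne (P? ∘ suc) (λ Pi Pj → Finₚ.suc-injective (unique Pi Pj))
... | yes P0 = ≤-reflexive (cong suc (sum-zero absent))
  where
  absent : ∀ i → ⟦ ⌊ P? (suc i) ⌋ ⟧ ≡ 0
  absent i with P? (suc i)
  ... | no _ = refl
  ... | yes Pi = contradiction (unique P0 Pi) λ ()

∣_∣-∑ : ∀ {n} (S : Subset n) → ∣ S ∣ ≡ ∑[ v < n ] ⟦ lookup S v ⟧
∣ [] ∣-∑ = refl
∣ true ∷ S ∣-∑ = cong suc ∣ S ∣-∑
∣ false ∷ S ∣-∑ = ∣ S ∣-∑

-- Domination, Roman domination and bondage

¬¬-isMin : ∀ (P : ℕ → Set) {k} → P k → ¬ ¬ ∃ (IsMin P)
¬¬-isMin P {k} Pk noMin = <-rec (λ k → ¬ P k) noneBelow k Pk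
  where
  noneBelow : ∀ k → (∀ {j} → j < k → ¬ P j) → ¬ P k
  noneBelow k below Pk = noMin (k , Pk , least)
    where
    least : ∀ j → P j → k ≤ j
    least j Pj with j <? k
    ... | yes j<k = ⊥-elim (below j<k Pj)
    ... | no j≮k = ≮⇒≥ j≮k

isMin-unique : ∀ {P : ℕ → Set} {a b} → IsMin P a → IsMin P b → a ≡ b
isMin-unique (Pa , a-least) (Pb , b-least) = ≤-antisym (a-least _ Pb) (b-least _ Pa)

module _ {n : ℕ} where

  IsSymmetric : Graph n → Set
  IsSymmetric G = ∀ i j → G i j ≡ G j i

  _⊆ᴳ_ : Graph n → Graph n → Set
  H ⊆ᴳ G = ∀ i j → H i j ≡ true → G i j ≡ true

  ─-symmetric : ∀ {G E} → IsSymmetric G → IsSymmetric E → IsSymmetric (G ─ E)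
  ─-symmetric symG symE i j = cong₂ (λ a b → a ∧ not b) (symG i j) (symE i j)

  ─-⊆ : ∀ G E → (G ─ E) ⊆ᴳ G
  ─-⊆ G E i j with G i j
  ... | true = λ _ → refl
  ... | false = id

  dominating-⊆ : ∀ {H G S} → H ⊆ᴳ G → Dominating H S → Dominating G S
  dominating-⊆ H⊆G dom v with dom v
  ... | inj₁ v∈S = inj₁ v∈S
  ... | inj₂ (u , u∈S , Huv) = inj₂ (u , u∈S , H⊆G u v Huv)

  romanDominating-⊆ : ∀ {H G f} → H ⊆ᴳ G → RomanDominating H f → RomanDominating G f
  romanDominating-⊆ H⊆G rdf v fv≡0 with rdf v fv≡0
  ... | u , Hvu , fu≡2 = u , H⊆G v u Hvu , fu≡2

  degree-∑ : ∀ G u → degree G u ≡ ∑[ v < n ] ⟦ G u v ⟧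
  degree-∑ G u = sum-allFin (λ v → ⟦ G u v ⟧)

  degree-mono : ∀ {H G} → H ⊆ᴳ G → ∀ u → degree H u ≤ degree G u
  degree-mono {H} {G} H⊆G u = subst₂ _≤_ (sym (degree-∑ H u)) (sym (degree-∑ G u)) (sum-mono-≤ edgewise)
    where
    edgewise : ∀ v → ⟦ H u v ⟧ ≤ ⟦ G u v ⟧
    edgewise v with H u v in Huv
    ... | false = z≤n
    ... | true rewrite H⊆G u v Huv = ≤-refl

  weight-∑ : ∀ f → weight f ≡ ∑[ v < n ] toℕ (f v)
  weight-∑ f = sum-allFin (toℕ ∘ f)

  toRoman : Subset n → Fin n → Fin 3
  toRoman S v = if lookup S v then 2F else 0F

  toRoman-romanDominating : ∀ {G S} → IsSymmetric G → Dominating G S → RomanDominating G (toRoman S)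
  toRoman-romanDominating {S = S} symG dom v fv≡0 with lookup S v in Sv | dom v
  toRoman-romanDominating symG dom v () | true | _
  ... | false | inj₁ v∈S = contradiction (trans (sym ([]=⇒lookup v∈S)) Sv) λ ()
  ... | false | inj₂ (u , u∈S , Guv) =
    u , trans (symG v u) Guv , cong (λ b → if b then 2F else 0F) ([]=⇒lookup u∈S)

  weight-toRoman : ∀ S → weight (toRoman S) ≡ 2 * ∣ S ∣
  weight-toRoman S = begin
    weight (toRoman S)               ≡⟨ weight-∑ (toRoman S) ⟩
    ∑[ v < n ] toℕ (toRoman S v)     ≡⟨ sum-cong-≗ (λ v → doubled (lookup S v)) ⟩
    ∑[ v < n ] (2 * ⟦ lookup S v ⟧)  ≡⟨ *-distribˡ-sum 2 (⟦_⟧ ∘ lookup S) ⟨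
    2 * ∑[ v < n ] ⟦ lookup S v ⟧    ≡⟨ cong (2 *_) ∣ S ∣-∑ ⟨
    2 * ∣ S ∣                        ∎
    where
    open ≡-Reasoning
    doubled : ∀ b → toℕ (if b then 2F else 0F) ≡ 2 * ⟦ b ⟧
    doubled true = refl
    doubled false = refl

  dominating⇒roman : ∀ {G d} → IsSymmetric G → Σ (Subset n) (λ S → Dominating G S × ∣ S ∣ ≡ d) →
                     Σ (Fin n → Fin 3) λ f → RomanDominating G f × weight f ≡ 2 * d
  dominating⇒roman symG (S , dom , ∣S∣≡d) =
    toRoman S , toRoman-romanDominating symG dom , trans (weight-toRoman S) (cong (2 *_) ∣S∣≡d)

  romanNum≤2*domNum : ∀ {G g r} → IsSymmetric G → DomNum G g → RomanNum G r → r ≤ 2 * g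
  romanNum≤2*domNum symG (dominatingSet , _) (_ , r-least) = r-least _ (dominating⇒roman symG dominatingSet)

  romanIncreases⇒domIncreases : ∀ {G H} → IsSymmetric G → IsSymmetric H → IsRoman G →
                                RomanIncreases G H → DomIncreases G H
  romanIncreases⇒domIncreases symG symH roman increasesᴿ g h γG γH =
    decidable-stable (g <? h) λ g≮h →
      ¬¬-isMin _ (dominating⇒roman symG (proj₁ γG)) λ { (r , γᴿG) →
      ¬¬-isMin _ (dominating⇒roman symH (proj₁ γH)) λ { (s , γᴿH) →
        g≮h (*-cancelˡ-< 2 g h (begin-strict
          2 * g  ≡⟨ roman g r γG γᴿG ⟨
          r      <⟨ increasesᴿ r s γᴿG γᴿH ⟩
          s      ≤⟨ romanNum≤2*domNum symH γH γᴿH ⟩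
          2 * h  ∎)) } }
    where open ≤-Reasoning

bondage≤romanBondage : ∀ {n} (G : Graph n) → Simple G → IsRoman G →
                       ∀ b bR → BondageNum G b → RomanBondageNum G bR → b ≤ bR
bondage≤romanBondage G (symG , _) roman _ bR (_ , b-least) ((E , E⊆G@(symE , _) , ∣E∣ , increasesᴿ) , _) =
  b-least bR (E , E⊆G , ∣E∣ , romanIncreases⇒domIncreases symG (─-symmetric symG symE) roman increasesᴿ)

-- Counting edges

module _ {n : ℕ} where

  SameEdge : Fin n → Fin n → Fin n → Fin n → Set
  SameEdge a b c d = (a ≡ c × b ≡ d) ⊎ (a ≡ d × b ≡ c)

  sameEdge-sym : ∀ {a b c d} → SameEdge a b c d → SameEdge c d a b
  sameEdge-sym (inj₁ (refl , refl)) = inj₁ (refl , refl)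
  sameEdge-sym (inj₂ (refl , refl)) = inj₂ (refl , refl)

  sameEdge-trans : ∀ {a b c d e f} → SameEdge a b c d → SameEdge c d e f → SameEdge a b e f
  sameEdge-trans (inj₁ (refl , refl)) same = same
  sameEdge-trans (inj₂ (refl , refl)) (inj₁ (refl , refl)) = inj₂ (refl , refl)
  sameEdge-trans (inj₂ (refl , refl)) (inj₂ (refl , refl)) = inj₁ (refl , refl)

  edgeCount-∑ : ∀ (E : Graph n) → edgeCount E ≡ ∑[ i < n ] ∑[ j < n ] ⟦ (toℕ i <ᵇ toℕ j) ∧ E i j ⟧
  edgeCount-∑ E =
    trans (cong sumᴸ (map-cong (λ i → sum-allFin (λ j → ⟦ (toℕ i <ᵇ toℕ j) ∧ E i j ⟧)) (allFin n)))
          (sum-allFin (λ i → ∑[ j < n ] ⟦ (toℕ i <ᵇ toℕ j) ∧ E i j ⟧))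

  counted-once : ∀ {E : Graph n} → IsSymmetric E → ∀ {a b} → E a b ≡ true → a ≢ b →
                 ∃ λ i → ∃ λ j → ⟦ (toℕ i <ᵇ toℕ j) ∧ E i j ⟧ ≡ 1 × SameEdge i j a b
  counted-once symE {a} {b} Eab a≢b with <-cmp (toℕ a) (toℕ b)
  ... | tri< a<b _ _ = a , b , cong₂ (λ x y → ⟦ x ∧ y ⟧) (T⇒≡true (<⇒<ᵇ a<b)) Eab , inj₁ (refl , refl)
  ... | tri≈ _ a≡b _ = contradiction (Finₚ.toℕ-injective a≡b) a≢b
  ... | tri> _ _ b<a =
    b , a , cong₂ (λ x y → ⟦ x ∧ y ⟧) (T⇒≡true (<⇒<ᵇ b<a)) (trans (symE b a) Eab) , inj₂ (refl , refl)

  2≤edgeCount : ∀ {E : Graph n} → IsSymmetric E → ∀ {a b c d} → E a b ≡ true → E c d ≡ true →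
                a ≢ b → c ≢ d → ¬ SameEdge a b c d → 2 ≤ edgeCount E
  2≤edgeCount {E} symE Eab Ecd a≢b c≢d different
    with counted-once symE Eab a≢b | counted-once symE Ecd c≢d
  ... | i , j , ij-counted , ij≈ab | k , l , kl-counted , kl≈cd =
    subst (2 ≤_) (sym (edgeCount-∑ E))
      (subst₂ (λ x y → x + y ≤ ∑[ i < n ] ∑[ j < n ] ⟦ (toℕ i <ᵇ toℕ j) ∧ E i j ⟧) ij-counted kl-counted
        (two-entries≤∑∑ (λ i j → ⟦ (toℕ i <ᵇ toℕ j) ∧ E i j ⟧) distinctPositions))
    where
    distinctPositions : i ≢ k ⊎ j ≢ l
    distinctPositions with i ≟ k | j ≟ l
    ... | no i≢k | _ = inj₁ i≢k
    ... | yes _ | no j≢l = inj₂ j≢l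
    ... | yes refl | yes refl = contradiction (sameEdge-trans (sameEdge-sym ij≈ab) kl≈cd) different

-- Lower bounds for graphs of maximum degree two

nonzero isTwo : Fin 3 → ℕ
nonzero 0F = 0
nonzero _ = 1
isTwo 2F = 1
isTwo _ = 0

-- A vertex labelled a with d neighbours Roman-dominates at most covers a d vertices.
covers : Fin 3 → ℕ → ℕ
covers a d = nonzero a + isTwo a * d

covers-bound : ∀ a {d} → d ≤ 2 → 2 * covers a d ≤ 3 * toℕ a
covers-bound 0F d≤2 = z≤n
covers-bound 1F d≤2 = s≤s (s≤s z≤n)
covers-bound 2F {d} d≤2 = *-monoʳ-≤ 2 (s≤s (subst (_≤ 2) (sym (*-identityˡ d)) d≤2))

covers-isolated : ∀ a → a ≢ 0F → 2 * covers a 0 < 3 * toℕ a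
covers-isolated 0F a≢0 = contradiction refl a≢0
covers-isolated 1F a≢0 = s≤s (s≤s (s≤s z≤n))
covers-isolated 2F a≢0 = s≤s (s≤s (s≤s z≤n))

module _ {n} {G : Graph n} (symG : IsSymmetric G) where

  n≤∑covers : ∀ {f} → RomanDominating G f → n ≤ ∑[ u < n ] covers (f u) (degree G u)
  n≤∑covers {f} rdf = begin
    n                                                         ≡⟨ ∑-one n ⟨
    ∑[ v < n ] 1                                              ≤⟨ sum-mono-≤ dominated ⟩
    ∑[ v < n ] (nonzero (f v) + ∑[ u < n ] (isTwo (f u) * ⟦ G u v ⟧))
      ≡⟨ ∑-distrib-+ (nonzero ∘ f) _ ⟩
    ∑[ v < n ] nonzero (f v) + ∑[ v < n ] ∑[ u < n ] (isTwo (f u) * ⟦ G u v ⟧)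
      ≡⟨ cong (∑[ v < n ] nonzero (f v) +_) (∑-comm (λ v u → isTwo (f u) * ⟦ G u v ⟧)) ⟩
    ∑[ v < n ] nonzero (f v) + ∑[ u < n ] ∑[ v < n ] (isTwo (f u) * ⟦ G u v ⟧)
      ≡⟨ cong (∑[ v < n ] nonzero (f v) +_) (sum-cong-≗ λ u →
           trans (cong (isTwo (f u) *_) (degree-∑ G u)) (*-distribˡ-sum (isTwo (f u)) (λ v → ⟦ G u v ⟧))) ⟨
    ∑[ v < n ] nonzero (f v) + ∑[ u < n ] (isTwo (f u) * degree G u)
      ≡⟨ ∑-distrib-+ (nonzero ∘ f) _ ⟨
    ∑[ u < n ] covers (f u) (degree G u)                      ∎
    where
    open ≤-Reasoning
    dominated : ∀ v → 1 ≤ nonzero (f v) + ∑[ u < n ] (isTwo (f u) * ⟦ G u v ⟧)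
    dominated v with f v in fv
    ... | 1F = s≤s z≤n
    ... | 2F = s≤s z≤n
    ... | 0F with rdf v fv
    ...   | u , Gvu , fu≡2 =
      ≤-trans (≤-reflexive (cong₂ (λ a b → isTwo a * ⟦ b ⟧) (sym fu≡2) (sym (trans (symG u v) Gvu))))
              (term≤sum (λ u → isTwo (f u) * ⟦ G u v ⟧) u)

  2n≤∑2covers : ∀ {f} → RomanDominating G f → 2 * n ≤ ∑[ u < n ] (2 * covers (f u) (degree G u))
  2n≤∑2covers {f} rdf =
    ≤-trans (*-monoʳ-≤ 2 (n≤∑covers rdf)) (≤-reflexive (*-distribˡ-sum 2 (λ u → covers (f u) (degree G u))))

  3*weight-∑ : ∀ f → 3 * weight f ≡ ∑[ u < n ] (3 * toℕ (f u))
  3*weight-∑ f = trans (cong (3 *_) (weight-∑ f)) (*-distribˡ-sum 3 (toℕ ∘ f))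

  module _ (degree≤2 : ∀ u → degree G u ≤ 2) where

    2n≤3*weight : ∀ {f} → RomanDominating G f → 2 * n ≤ 3 * weight f
    2n≤3*weight {f} rdf = begin
      2 * n                                         ≤⟨ 2n≤∑2covers rdf ⟩
      ∑[ u < n ] (2 * covers (f u) (degree G u))
        ≤⟨ sum-mono-≤ (λ u → covers-bound (f u) (degree≤2 u)) ⟩
      ∑[ u < n ] (3 * toℕ (f u))                   ≡⟨ 3*weight-∑ f ⟨
      3 * weight f                                  ∎
      where open ≤-Reasoning

    2n<3*weight : ∀ {f} v → (∀ u → G v u ≡ false) → RomanDominating G f → 2 * n < 3 * weight f
    2n<3*weight {f} v isolated rdf = begin-strict
      2 * n                                         ≤⟨ 2n≤∑2covers rdf ⟩
      ∑[ u < n ] (2 * covers (f u) (degree G u))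
        <⟨ sum-mono-< (λ u → covers-bound (f u) (degree≤2 u)) v isolated-strict ⟩
      ∑[ u < n ] (3 * toℕ (f u))                   ≡⟨ 3*weight-∑ f ⟨
      3 * weight f                                  ∎
      where
      open ≤-Reasoning
      fv≢0 : f v ≢ 0F
      fv≢0 fv≡0 with rdf v fv≡0
      ... | u , Gvu , _ = contradiction (trans (sym Gvu) (isolated u)) λ ()
      degree≡0 : degree G v ≡ 0
      degree≡0 = trans (degree-∑ G v) (sum-zero (λ u → cong ⟦_⟧ (isolated u)))
      isolated-strict : 2 * covers (f v) (degree G v) < 3 * toℕ (f v)
      isolated-strict =
        subst (λ d → 2 * covers (f v) d < 3 * toℕ (f v)) (sym degree≡0) (covers-isolated (f v) fv≢0)

    3*weight-toRoman : ∀ (S : Subset n) → 3 * weight (toRoman S) ≡ 2 * (3 * ∣ S ∣)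
    3*weight-toRoman S =
      trans (cong (3 *_) (weight-toRoman S)) (trans (sym (*-assoc 3 2 ∣ S ∣)) (*-assoc 2 3 ∣ S ∣))

    n≤3*∣S∣ : ∀ {S} → Dominating G S → n ≤ 3 * ∣ S ∣
    n≤3*∣S∣ {S} dom = *-cancelˡ-≤ 2 (subst (2 * n ≤_) (3*weight-toRoman S)
      (2n≤3*weight (toRoman-romanDominating symG dom)))

    n<3*∣S∣ : ∀ {S} v → (∀ u → G v u ≡ false) → Dominating G S → n < 3 * ∣ S ∣
    n<3*∣S∣ {S} v isolated dom = *-cancelˡ-< 2 n (3 * ∣ S ∣) (subst (2 * n <_) (3*weight-toRoman S)
      (2n<3*weight v isolated (toRoman-romanDominating symG dom)))

-- Cycles of length divisible by three

-- Both recursions below rely on (3 + a) % 3 reducing to a % 3 definitionally.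
three-consecutive : ∀ a r → ⟦ a % 3 ≡ᵇ 2 ⟧ + (⟦ suc a % 3 ≡ᵇ 2 ⟧ + (⟦ suc (suc a) % 3 ≡ᵇ 2 ⟧ + r)) ≡ suc r
three-consecutive 0 r = refl
three-consecutive 1 r = refl
three-consecutive 2 r = refl
three-consecutive (suc (suc (suc a))) r = three-consecutive a r

count-residue : ∀ k a → ∑[ w < k * 3 ] ⟦ (toℕ w + a) % 3 ≡ᵇ 2 ⟧ ≡ k
count-residue zero a = refl
count-residue (suc k) a = trans (three-consecutive a _) (cong suc (count-residue k a))

module Cycle (p : ℕ) (3∣n : 3 ∣ 3 + p) where

  n : ℕ
  n = 3 + p

  C : Graph n
  C = cycle (2 + p)

  next : Fin n → Fin n
  next w = fromℕ< (m%n<n (suc (toℕ w)) n)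

  toℕ-next : ∀ w → toℕ (next w) ≡ suc (toℕ w) % n
  toℕ-next w = Finₚ.toℕ-fromℕ< (m%n<n (suc (toℕ w)) n)

  next-0 : next 0F ≡ 1F
  next-0 = Finₚ.toℕ-injective (toℕ-next 0F)

  next-1 : next 1F ≡ 2F
  next-1 = Finₚ.toℕ-injective (toℕ-next 1F)

  C-symmetric : IsSymmetric C
  C-symmetric i j = ∨-comm (suc (toℕ i) % n ≡ᵇ toℕ j) _

  C-next : ∀ w → C w (next w) ≡ true
  C-next w = cong (_∨ (suc (toℕ (next w)) % n ≡ᵇ toℕ w)) forward
    where
    forward : (suc (toℕ w) % n ≡ᵇ toℕ (next w)) ≡ true
    forward = subst (λ x → (suc (toℕ w) % n ≡ᵇ x) ≡ true) (sym (toℕ-next w))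
                    (T⇒≡true (≡⇒≡ᵇ (suc (toℕ w) % n) _ refl))

  C-edge : ∀ i j → C i j ≡ true → j ≡ next i ⊎ i ≡ next j
  C-edge i j Cij with suc (toℕ i) % n ≡ᵇ toℕ j in e
  ... | true = inj₁ (Finₚ.toℕ-injective (trans (sym (≡ᵇ⇒≡ _ _ (≡true⇒T e))) (sym (toℕ-next i))))
  ... | false = inj₂ (Finₚ.toℕ-injective (trans (sym (≡ᵇ⇒≡ _ _ (≡true⇒T Cij))) (sym (toℕ-next j))))

  -- Since 2 ≡ -1 (mod 3), this is (w - u) mod 3.
  residue : Fin n → Fin n → ℕ
  residue u w = (toℕ w + 2 * toℕ u) % 3

  residue<3 : ∀ u w → residue u w < 3
  residue<3 u w = m%n<n (toℕ w + 2 * toℕ u) 3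

  residue-self : ∀ u → residue u u ≡ 0
  residue-self u = trans (cong (_% 3) (*-comm 3 (toℕ u))) (m*n%n≡0 (toℕ u) 3)

  -- Needs 3 ∣ n: only then does wrapping around from n - 1 to 0 preserve the count modulo 3.
  residue-next : ∀ u w → residue u (next w) ≡ suc (residue u w) % 3
  residue-next u w = begin
    (toℕ (next w) + 2 * toℕ u) % 3                   ≡⟨ cong (λ x → (x + 2 * toℕ u) % 3) (toℕ-next w) ⟩
    (suc (toℕ w) % n + 2 * toℕ u) % 3                ≡⟨ %-distribˡ-+ (suc (toℕ w) % n) (2 * toℕ u) 3 ⟩
    (suc (toℕ w) % n % 3 + 2 * toℕ u % 3) % 3        ≡⟨ cong (λ x → (x + 2 * toℕ u % 3) % 3)
                                                          (m∣n⇒o%n%m≡o%m 3 n (suc (toℕ w)) 3∣n) ⟩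
    (suc (toℕ w) % 3 + 2 * toℕ u % 3) % 3            ≡⟨ %-distribˡ-+ (suc (toℕ w)) (2 * toℕ u) 3 ⟨
    (1 + (toℕ w + 2 * toℕ u)) % 3                    ≡⟨ %-distribˡ-+ 1 (toℕ w + 2 * toℕ u) 3 ⟩
    suc (residue u w) % 3                            ∎
    where open ≡-Reasoning

  next≢id : ∀ w → next w ≢ w
  next≢id w next≡w = shift≢ (residue 0F w) (residue<3 0F w)
    (trans (sym (residue-next 0F w)) (cong (residue 0F) next≡w))
    where
    shift≢ : ∀ x → x < 3 → suc x % 3 ≢ x
    shift≢ 0 _ ()
    shift≢ 1 _ ()
    shift≢ 2 _ ()
    shift≢ (suc (suc (suc _))) (s≤s (s≤s (s≤s ())))

  next²≢id : ∀ w → next (next w) ≢ w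
  next²≢id w next²≡w = shift²≢ (residue 0F w) (residue<3 0F w)
    (trans (sym (trans (residue-next 0F (next w)) (cong (λ x → suc x % 3) (residue-next 0F w))))
           (cong (residue 0F) next²≡w))
    where
    shift²≢ : ∀ x → x < 3 → suc (suc x % 3) % 3 ≢ x
    shift²≢ 0 _ ()
    shift²≢ 1 _ ()
    shift²≢ 2 _ ()
    shift²≢ (suc (suc (suc _))) (s≤s (s≤s (s≤s ())))

  toℕ-next-cases : ∀ w → (suc (toℕ w) ≡ n × toℕ (next w) ≡ 0) ⊎ toℕ (next w) ≡ suc (toℕ w)
  toℕ-next-cases w with m≤n⇒m<n∨m≡n (Finₚ.toℕ<n w)
  ... | inj₁ w+1<n = inj₂ (trans (toℕ-next w) (m<n⇒m%n≡m w+1<n))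
  ... | inj₂ w+1≡n = inj₁ (w+1≡n , trans (toℕ-next w) (trans (cong (_% n) w+1≡n) (n%n≡0 n)))

  next-injective : ∀ {v w} → next v ≡ next w → v ≡ w
  next-injective {v} {w} eq with toℕ-next-cases v | toℕ-next-cases w
  ... | inj₂ v+1 | inj₂ w+1 = Finₚ.toℕ-injective (suc-injective (trans (sym v+1) (trans (cong toℕ eq) w+1)))
  ... | inj₁ (_ , v↦0) | inj₂ w+1 = contradiction (trans (sym v↦0) (trans (cong toℕ eq) w+1)) λ ()
  ... | inj₂ v+1 | inj₁ (_ , w↦0) = contradiction (trans (sym w↦0) (trans (cong toℕ (sym eq)) v+1)) λ ()
  ... | inj₁ (v+1≡n , _) | inj₁ (w+1≡n , _) = Finₚ.toℕ-injective (suc-injective (trans v+1≡n (sym w+1≡n)))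

  next-surjective : ∀ w → ∃ λ v → next v ≡ w
  next-surjective 0F = fromℕ (2 + p) , Finₚ.toℕ-injective
    (trans (toℕ-next (fromℕ (2 + p))) (trans (cong (λ x → suc x % n) (Finₚ.toℕ-fromℕ (2 + p))) (n%n≡0 n)))
  next-surjective (suc w) = inject₁ w , Finₚ.toℕ-injective
    (trans (toℕ-next (inject₁ w))
           (trans (cong (λ x → suc x % n) (Finₚ.toℕ-inject₁ w)) (m<n⇒m%n≡m (s≤s (Finₚ.toℕ<n w)))))

  degree-C : ∀ u → degree C u ≤ 2
  degree-C u = begin
    degree C u                                                         ≡⟨ degree-∑ C u ⟩
    ∑[ v < n ] ⟦ C u v ⟧                                               ≤⟨ sum-mono-≤ neighbours ⟩
    ∑[ v < n ] (⟦ ⌊ v ≟ next u ⌋ ⟧ + ⟦ ⌊ u ≟ next v ⌋ ⟧)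
      ≡⟨ ∑-distrib-+ (λ v → ⟦ ⌊ v ≟ next u ⌋ ⟧) (λ v → ⟦ ⌊ u ≟ next v ⌋ ⟧) ⟩
    ∑[ v < n ] ⟦ ⌊ v ≟ next u ⌋ ⟧ + ∑[ v < n ] ⟦ ⌊ u ≟ next v ⌋ ⟧ ≤⟨ +-mono-≤ successor predecessor ⟩
    2                                                                  ∎
    where
    open ≤-Reasoning
    neighbours : ∀ v → ⟦ C u v ⟧ ≤ ⟦ ⌊ v ≟ next u ⌋ ⟧ + ⟦ ⌊ u ≟ next v ⌋ ⟧
    neighbours v with C u v in Cuv
    ... | false = z≤n
    ... | true with C-edge u v Cuv | v ≟ next u | u ≟ next v
    ...   | inj₁ _       | yes _       | _           = s≤s z≤n
    ...   | inj₁ v≡next  | no v≢next   | _           = contradiction v≡next v≢next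
    ...   | inj₂ _       | _           | yes _       = m≤n+m 1 _
    ...   | inj₂ u≡next  | _           | no u≢next   = contradiction u≡next u≢next
    successor : ∑[ v < n ] ⟦ ⌊ v ≟ next u ⌋ ⟧ ≤ 1
    successor = sum-atMostOne (_≟ next u) λ i≡ j≡ → trans i≡ (sym j≡)
    predecessor : ∑[ v < n ] ⟦ ⌊ u ≟ next v ⌋ ⟧ ≤ 1
    predecessor = sum-atMostOne (λ v → u ≟ next v) λ i≡ j≡ → next-injective (trans (sym i≡) j≡)

  k : ℕ
  k = _∣_.quotient 3∣n

  n≡3k : n ≡ 3 * k
  n≡3k = trans (_∣_.equality 3∣n) (*-comm k 3)

  2n≡3*2k : 2 * n ≡ 3 * (2 * k)
  2n≡3*2k = trans (cong (2 *_) n≡3k) (trans (sym (*-assoc 2 3 k)) (*-assoc 3 2 k))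

  -- Every third vertex, phased so that the edge {u, next u} is never used: u is dominated
  -- by its predecessor and next u by its successor.
  D : Fin n → Subset n
  D u = Vec.tabulate (λ w → residue u w ≡ᵇ 2)

  ∈D : ∀ u {w} → residue u w ≡ 2 → w ∈ D u
  ∈D u {w} r≡2 = lookup⇒[]= w (D u) (trans (lookup∘tabulate (λ w → residue u w ≡ᵇ 2) w) (cong (_≡ᵇ 2) r≡2))

  ∣D∣ : ∀ u → ∣ D u ∣ ≡ k
  ∣D∣ u = begin
    ∣ D u ∣                                        ≡⟨ ∣ D u ∣-∑ ⟩
    ∑[ w < n ] ⟦ lookup (D u) w ⟧                  ≡⟨ sum-cong-≗ (cong ⟦_⟧ ∘ lookup∘tabulate (λ w → residue u w ≡ᵇ 2)) ⟩
    ∑[ w < n ] ⟦ residue u w ≡ᵇ 2 ⟧                ≡⟨ subst (λ N → ∑[ w < N ] ⟦ (toℕ w + 2 * toℕ u) % 3 ≡ᵇ 2 ⟧ ≡ k)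
                                                          (sym (_∣_.equality 3∣n)) (count-residue k (2 * toℕ u)) ⟩
    k                                              ∎
    where open ≡-Reasoning

  AlmostCycle : Fin n → Graph n → Set
  AlmostCycle u H = IsSymmetric H × H ⊆ᴳ C × (∀ w → w ≢ u → H w (next w) ≡ true)

  D-dominating : ∀ {u H} → AlmostCycle u H → Dominating H (D u)
  D-dominating {u} (symH , _ , pathH) w with residue u w in r | residue<3 u w
  ... | suc (suc (suc _)) | s≤s (s≤s (s≤s ()))
  ... | 2 | _ = inj₁ (∈D u r)
  ... | 1 | _ = inj₂ (next w , ∈D u (trans (residue-next u w) (cong (λ x → suc x % 3) r)) ,
                      trans (symH (next w) w) (pathH w w≢u))
    where
    w≢u : w ≢ u
    w≢u refl = contradiction (trans (sym r) (residue-self u)) λ ()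
  ... | 0 | _ with next-surjective w
  ...   | v , refl = inj₂ (v , ∈D u rv , pathH v v≢u)
    where
    wraps : ∀ x → x < 3 → suc x % 3 ≡ 0 → x ≡ 2
    wraps 2 _ _ = refl
    wraps (suc (suc (suc _))) (s≤s (s≤s (s≤s ())))
    rv : residue u v ≡ 2
    rv = wraps (residue u v) (residue<3 u v) (trans (sym (residue-next u v)) r)
    v≢u : v ≢ u
    v≢u refl = contradiction (trans (sym rv) (residue-self u)) λ ()

  k≤∣S∣ : ∀ {S} → Dominating C S → k ≤ ∣ S ∣
  k≤∣S∣ {S} dom = *-cancelˡ-≤ 3 (subst (_≤ 3 * ∣ S ∣) n≡3k (n≤3*∣S∣ C-symmetric degree-C dom))

  2k≤weight : ∀ {f} → RomanDominating C f → 2 * k ≤ weight f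
  2k≤weight {f} rdf = *-cancelˡ-≤ 3 (subst (_≤ 3 * weight f) 2n≡3*2k (2n≤3*weight C-symmetric degree-C rdf))

  domNum-almostCycle : ∀ {u H} → AlmostCycle u H → DomNum H k
  domNum-almostCycle {u} almost@(_ , H⊆C , _) =
    (D u , D-dominating almost , ∣D∣ u) ,
    λ { m (S , dom , ∣S∣≡m) → subst (k ≤_) ∣S∣≡m (k≤∣S∣ (dominating-⊆ H⊆C dom)) }

  romanNum-almostCycle : ∀ {u H} → AlmostCycle u H → RomanNum H (2 * k)
  romanNum-almostCycle {u} almost@(symH , H⊆C , _) =
    dominating⇒roman symH (D u , D-dominating almost , ∣D∣ u) ,
    λ { m (f , rdf , weight≡m) → subst (2 * k ≤_) weight≡m (2k≤weight (romanDominating-⊆ H⊆C rdf)) }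

  C-almostCycle : AlmostCycle 0F C
  C-almostCycle = C-symmetric , (λ _ _ → id) , λ w _ → C-next w

  C─E-almostCycle : ∀ {E u} → EdgeSubset C E → (∀ w → w ≢ u → E w (next w) ≡ false) → AlmostCycle u (C ─ E)
  C─E-almostCycle {E} (symE , _) kept =
    ─-symmetric C-symmetric symE , ─-⊆ C E , λ w w≢u → cong₂ (λ a b → a ∧ not b) (C-next w) (kept w w≢u)

  at-most-one-edge : ∀ {E} → EdgeSubset C E → edgeCount E ≤ 1 → ∃ λ u → ∀ w → w ≢ u → E w (next w) ≡ false
  at-most-one-edge {E} (symE , _) ∣E∣≤1 with any? (λ w → T? (E w (next w)))
  ... | no none = 0F , λ w _ → ¬-not (none ∘ (w ,_) ∘ ≡true⇒T)
  ... | yes (u , Eu) = u , λ w w≢u → ¬-not λ Ew →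
    <⇒≱ (s≤s ∣E∣≤1) (2≤edgeCount symE (T⇒≡true Eu) Ew (next≢id u ∘ sym) (next≢id w ∘ sym) (different w≢u))
    where
    different : ∀ {w} → w ≢ u → ¬ SameEdge u (next u) w (next w)
    different w≢u (inj₁ (u≡w , _)) = w≢u (sym u≡w)
    different w≢u (inj₂ (u≡next-w , next-u≡w)) = next²≢id _ (trans (cong next (sym u≡next-w)) next-u≡w)

  path0-1-2 : Fin n → Fin n → Bool
  path0-1-2 0F 1F = true
  path0-1-2 1F 2F = true
  path0-1-2 _ _ = false

  edgesAt1 : Graph n
  edgesAt1 i j = path0-1-2 i j ∨ path0-1-2 j i

  path0-1-2⇒next : ∀ i j → path0-1-2 i j ≡ true → j ≡ next i
  path0-1-2⇒next 0F 1F _ = sym next-0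
  path0-1-2⇒next 1F 2F _ = sym next-1
  path0-1-2⇒next 0F 0F ()
  path0-1-2⇒next 0F 2F ()
  path0-1-2⇒next 0F (suc (suc (suc _))) ()
  path0-1-2⇒next 1F 0F ()
  path0-1-2⇒next 1F 1F ()
  path0-1-2⇒next 1F (suc (suc (suc _))) ()
  path0-1-2⇒next 2F _ ()
  path0-1-2⇒next (suc (suc (suc _))) _ ()

  edgesAt1-edgeSubset : EdgeSubset C edgesAt1
  edgesAt1-edgeSubset = (λ i j → ∨-comm (path0-1-2 i j) _) , edgesAt1⊆C
    where
    edgesAt1⊆C : edgesAt1 ⊆ᴳ C
    edgesAt1⊆C i j Eij with path0-1-2 i j in ij
    ... | true = subst (λ x → C i x ≡ true) (sym (path0-1-2⇒next i j ij)) (C-next i)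
    ... | false =
      trans (C-symmetric i j) (subst (λ x → C j x ≡ true) (sym (path0-1-2⇒next j i Eij)) (C-next j))

  edgeCount-edgesAt1 : edgeCount edgesAt1 ≡ 2
  edgeCount-edgesAt1 = trans (edgeCount-∑ edgesAt1)
    (cong₂ _+_ (cong suc (laterColumns 0F λ _ → refl)) (cong₂ _+_ (cong suc (laterColumns 1F λ _ → refl))
      (cong₂ _+_ (laterColumns 2F λ _ → refl)
        (sum-zero {f = λ i → ∑[ j < n ] counted (suc (suc (suc i))) j} λ i → sum-zero (laterRow i)))))
    where
    counted : Fin n → Fin n → ℕ
    counted i j = ⟦ (toℕ i <ᵇ toℕ j) ∧ edgesAt1 i j ⟧
    laterColumns : ∀ i → (∀ j → counted i (suc (suc (suc j))) ≡ 0) →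
                   ∑[ j < p ] counted i (suc (suc (suc j))) ≡ 0
    laterColumns i = sum-zero
    laterRow : ∀ i j → counted (suc (suc (suc i))) j ≡ 0
    laterRow i 0F = refl
    laterRow i 1F = refl
    laterRow i 2F = refl
    laterRow i (suc (suc (suc j))) = cong ⟦_⟧ (∧-zeroʳ _)

  1-isolated : ∀ j → (C ─ edgesAt1) 1F j ≡ false
  1-isolated j with C 1F j in C1j
  ... | false = refl
  ... | true with C-edge 1F j C1j
  ...   | inj₁ j≡next = cong (λ x → not (edgesAt1 1F x)) (trans j≡next next-1)
  ...   | inj₂ 1≡next =
    cong (λ x → not (edgesAt1 1F x)) (next-injective {j} {0F} (trans (sym 1≡next) (sym next-0)))

  C─edgesAt1-symmetric : IsSymmetric (C ─ edgesAt1)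
  C─edgesAt1-symmetric = ─-symmetric C-symmetric (proj₁ edgesAt1-edgeSubset)

  degree-C─edgesAt1 : ∀ u → degree (C ─ edgesAt1) u ≤ 2
  degree-C─edgesAt1 u = ≤-trans (degree-mono (─-⊆ C edgesAt1) u) (degree-C u)

  k<∣S∣ : ∀ {S} → Dominating (C ─ edgesAt1) S → k < ∣ S ∣
  k<∣S∣ {S} dom = *-cancelˡ-< 3 k ∣ S ∣
    (subst (_< 3 * ∣ S ∣) n≡3k (n<3*∣S∣ C─edgesAt1-symmetric degree-C─edgesAt1 1F 1-isolated dom))

  2k<weight : ∀ {f} → RomanDominating (C ─ edgesAt1) f → 2 * k < weight f
  2k<weight {f} rdf = *-cancelˡ-< 3 (2 * k) (weight f)
    (subst (_< 3 * weight f) 2n≡3*2k (2n<3*weight C─edgesAt1-symmetric degree-C─edgesAt1 1F 1-isolated rdf))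

  minimalRemoval≡2 : ∀ (Increases : Graph n → Set) → Increases (C ─ edgesAt1) →
              (∀ {u E} → AlmostCycle u (C ─ E) → ¬ Increases (C ─ E)) →
              IsMin (λ b → Σ (Graph n) λ E → EdgeSubset C E × edgeCount E ≡ b × Increases (C ─ E)) 2
  minimalRemoval≡2 Increases increases unchanged =
    (edgesAt1 , edgesAt1-edgeSubset , edgeCount-edgesAt1 , increases) , least
    where
    least : ∀ b → Σ (Graph n) (λ E → EdgeSubset C E × edgeCount E ≡ b × Increases (C ─ E)) → 2 ≤ b
    least b (E , E⊆C , ∣E∣≡b , increasesᴱ) with 2 ≤? b
    ... | yes 2≤b = 2≤b
    ... | no 2≰b with at-most-one-edge E⊆C (subst (_≤ 1) (sym ∣E∣≡b) (≤-pred (≰⇒> 2≰b)))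
    ...   | u , kept = contradiction increasesᴱ (unchanged (C─E-almostCycle E⊆C kept))

  bondageNum : BondageNum C 2
  bondageNum = minimalRemoval≡2 (DomIncreases C) increases unchanged
    where
    γC : DomNum C k
    γC = domNum-almostCycle C-almostCycle
    increases : DomIncreases C (C ─ edgesAt1)
    increases g h γ ((S , dom , ∣S∣≡h) , _) = subst₂ _<_ (isMin-unique γC γ) ∣S∣≡h (k<∣S∣ dom)
    unchanged : ∀ {u E} → AlmostCycle u (C ─ E) → ¬ DomIncreases C (C ─ E)
    unchanged almost increasesᴱ = <-irrefl refl (increasesᴱ k k γC (domNum-almostCycle almost))

  romanBondageNum : RomanBondageNum C 2
  romanBondageNum = minimalRemoval≡2 (RomanIncreases C) increases unchanged
    where
    γᴿC : RomanNum C (2 * k)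
    γᴿC = romanNum-almostCycle C-almostCycle
    increases : RomanIncreases C (C ─ edgesAt1)
    increases r s γᴿ ((f , rdf , weight≡s) , _) = subst₂ _<_ (isMin-unique γᴿC γᴿ) weight≡s (2k<weight rdf)
    unchanged : ∀ {u E} → AlmostCycle u (C ─ E) → ¬ RomanIncreases C (C ─ E)
    unchanged almost increasesᴱ = <-irrefl refl (increasesᴱ _ _ γᴿC (romanNum-almostCycle almost))

bondage≡romanBondage-cycle : ∀ m → suc m % 3 ≡ 0 →
                             ∃ λ b → BondageNum (cycle m) b × RomanBondageNum (cycle m) b
bondage≡romanBondage-cycle 0 ()
bondage≡romanBondage-cycle 1 ()
bondage≡romanBondage-cycle (suc (suc p)) n%3≡0 = 2 , Cycle.bondageNum p 3∣n , Cycle.romanBondageNum p 3∣n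
  where
  3∣n : 3 ∣ 3 + p
  3∣n = m%n≡0⇒n∣m (3 + p) 3 n%3≡0

theorem8 : (∀ {n} (G : Graph n) → Simple G → MaxDegree≥2 G → IsRoman G →
               ∀ b bR → BondageNum G b → RomanBondageNum G bR → b ≤ bR)
             × (∀ m → suc m % 3 ≡ 0 →
               ∃ λ b → BondageNum (cycle m) b × RomanBondageNum (cycle m) b)
theorem8 = (λ G simple _ → bondage≤romanBondage G simple) , bondage≡romanBondage-cycle
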